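{- Let $r\ge 1$ and $n\ge 1$ be integers, and let $a_n^r$ be the number of preference orderings of an $n$-element set all of whose blocks have size at most $r$. Then $$a_n^r=n!\,F^{[r]}_{n+r-1}\Big(1,\tfrac{1}{2!},\tfrac{1}{3!},\dots,\tfrac{1}{r!}\Big).$$
   Context: For an integer $r\ge 1$, the $r$-Fibonacci polynomial $F^{[r]}_n(x_1,\dots,x_r)$ is defined by $F^{[r]}_n=0$ for $0\le n<r-1$, $F^{[r]}_{r-1}=1$, and $F^{[r]}_n=\sum_{i=1}^r x_iF^{[r]}_{n-i}$ for $n\ge r$. A preference ordering of a finite set is an ordered set partition: a partition of the set into nonempty blocks together with a linear order on the blocks. -}

module Defs where

open import Data.Nat using (ℕ; zero; suc; _≤_; _<ᵇ_; _≡ᵇ_; _∸_; _!)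
open import Data.Nat.Properties using (_!≢0)
open import Data.Bool using (if_then_else_)
open import Data.List using (List; []; _∷_; zipWith; foldr)
open import Data.Vec using (Vec; toList; tabulate)
open import Data.Fin using (Fin; toℕ)
open import Data.Fin.Subset using (Subset; ∣_∣; _∩_; ⋃; ⊥; ⊤)
open import Data.List.Relation.Unary.All using (All)
open import Data.List.Relation.Unary.AllPairs using (AllPairs)
open import Data.Integer using (+_)
open import Data.Rational using (ℚ; 0ℚ; 1ℚ; _*_; _+_; _/_)
open import Relation.Binary.PropositionalEquality using (_≡_)

-- r-Fibonacci polynomials, evaluated at rational arguments x₁ … x_r.
--   F_n = 0 (n < r-1),  F_{r-1} = 1,  F_n = Σ_{i=1}^r x_i F_{n-i} (n ≥ r).

-- Given h = [F_{n-1}, F_{n-2}, …, F_0] (length n), compute F_n.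
-- For n ≥ r, zipWith pairs x_i with F_{n-i} for i = 1 … r exactly.
fibStep : (r : ℕ) → Vec ℚ r → ℕ → List ℚ → ℚ
fibStep r xs n h =
  if n <ᵇ (r ∸ 1) then 0ℚ
  else if n ≡ᵇ (r ∸ 1) then 1ℚ
  else foldr _+_ 0ℚ (zipWith _*_ (toList xs) h)

fibHist : (r : ℕ) → Vec ℚ r → ℕ → List ℚ
fibHist r xs zero    = []
fibHist r xs (suc n) = fibStep r xs n (fibHist r xs n) ∷ fibHist r xs n

rFib : (r : ℕ) → Vec ℚ r → ℕ → ℚ
rFib r xs n = fibStep r xs n (fibHist r xs n)

invFactorials : (r : ℕ) → Vec ℚ r
invFactorials r = tabulate λ (i : Fin r) → (+ 1 / (suc (toℕ i)) !) {{suc (toℕ i) !≢0}}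

-- The list gives the
-- blocks in their linear order; blocks are nonempty, pairwise disjoint,
-- and their union is the whole set.  All side conditions are
-- proof-irrelevant in substance (≤ on ℕ, ≡ on Subset n), so elements of
-- this type correspond exactly to such orderings.

record PrefOrdering (n r : ℕ) : Set where
  constructor prefOrdering
  field
    blocks   : List (Subset n)
    nonempty : All (λ b → 1 ≤ ∣ b ∣) blocks
    bounded  : All (λ b → ∣ b ∣ ≤ r) blocks
    disjoint : AllPairs (λ b c → b ∩ c ≡ ⊥) blocks
    covering : ⋃ blocks ≡ ⊤

module Submission where

-- A preference ordering of a set S is either empty (S = ∅) or a first block B ⊆ S with
-- 1 ≤ |B| ≤ r followed by a preference ordering of S ∖ B.  Counting along this decomposition
-- and grouping first blocks by size gives a_m = [m = 0] + Σ_{k=1}^{r} C(m,k) a_{m-k}.  Hence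
-- b_m = a_m / m! satisfies b_0 = 1 and b_m = Σ_{k=1}^{r} b_{m-k} / k! (b_j = 0 for j < 0), the
-- r-Fibonacci recurrence of F^{[r]}_{m+r-1}(1, 1/2!, …, 1/r!).  Cardinalities are tracked as
-- rationals (A HasSize q), so that the two recurrences can be compared directly.

open import Defs
open import Data.Nat using (ℕ; zero; suc; _≤_; _<_; _>_; _+_; _∸_; _!; _<ᵇ_; s≤s; z≤n; s≤s⁻¹; NonZero)
open import Data.Fin using (Fin; toℕ)
open import Data.Product using (Σ; _×_; _,_; proj₁; proj₂; Σ-syntax)
open import Data.Rational using (ℚ; _*_; _/_; mkℚ; 0ℚ; 1ℚ)
open import Data.Integer using (+_) renaming (_+_ to _+ℤ_)
open import Function.Bundles using (_↔_)
open import Relation.Binary.PropositionalEquality using (_≡_)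

import Data.Nat as ℕ
import Data.Rational as ℚ
import Data.Integer.Properties as ℤ
open import Algebra.Bundles using (CommutativeMonoid)
open import Axiom.UniquenessOfIdentityProofs using (UIP; module Decidable⇒UIP)
open import Data.Bool using (Bool; true; false; T; if_then_else_)
open import Data.Bool.Properties using (T-irrelevant) renaming (_≟_ to _≟ᵇ_)
open import Data.Empty using (⊥-elim)
open import Data.Fin.Properties using (+↔⊎; 1↔⊤)
open import Data.Fin.Subset using (Subset; outside; inside; ∣_∣; _∩_; _∪_; _─_; ⋃; ⊥; ⊤)
open import Data.Fin.Subset.Properties using (∣⊥∣≡0; ∣⊤∣≡n; ∩-zeroʳ; ∩-distribˡ-∪; ∪-identityˡ)
open import Data.List using (List; []; _∷_; zipWith; foldr)
open import Data.List.Relation.Unary.All as All using (All; []; _∷_)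
open import Data.List.Relation.Unary.AllPairs as AllPairs using (AllPairs; []; _∷_)
open import Data.Nat.Combinatorics using (_C_; nCk≡n!/k![n-k]!; k![n∸k]!∣n!; k>n⇒nCk≡0; nCk+nC[k+1]≡[n+1]C[k+1])
open import Data.Nat.Coprimality as Coprime using (1-coprimeTo)
open import Data.Nat.DivMod using (m/n*n≡m)
open import Data.Nat.Properties
  using (_!≢0; _!*_!≢0; ≤-irrelevant; ≤-refl; <⇒≤; <⇒<ᵇ; <ᵇ⇒<; ≡⇒≡ᵇ; ≡ᵇ⇒≡; <-irrefl; <⇒≢; <⇒≱;
         ≤-<-connex; <-≤-trans; m<m+n; 0≢1+n; +-suc; +-comm; +-∸-comm; +-∸-assoc; +-monoˡ-<;
         m+[n∸m]≡n; m+n∸n≡m; m≤n+m; m<n⇒m<1+n; module ≤-Reasoning)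
open import Data.Rational.Properties
  using (normalize-coprime; *-inverseʳ; +-identityˡ; +-identityʳ; +-assoc; *-identityˡ; *-identityʳ;
         *-zeroˡ; *-zeroʳ; *-distribˡ-+; *-distribʳ-+; *-assoc; *-comm; +-0-commutativeMonoid; *-1-commutativeMonoid)
open import Data.Sum using (_⊎_; inj₁; inj₂; [_,_]′)
open import Data.Sum.Function.Propositional using (_⊎-↔_)
open import Data.Unit using (tt)
open import Data.Vec using (Vec; []; _∷_; toList; tabulate)
open import Data.Vec.Properties using (≡-dec; ∷-injectiveˡ; ∷-injectiveʳ)
open import Function using (_∘_; _⇔_; mk⇔; mk↔ₛ′; Equivalence)
open import Function.Properties.Inverse using (↔-trans; ↔-sym)
open import Relation.Binary.PropositionalEquality using (refl; sym; trans; cong; cong₂; subst; module ≡-Reasoning)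
open import Relation.Nullary using (¬_; Irrelevant)

open import Algebra.Properties.CommutativeSemigroup (CommutativeMonoid.commutativeSemigroup +-0-commutativeMonoid)
  using () renaming (interchange to +-interchange)
open import Algebra.Properties.CommutativeSemigroup (CommutativeMonoid.commutativeSemigroup *-1-commutativeMonoid)
  using () renaming (interchange to *-interchange)

private
  variable
    A B : Set
    p q : ℚ
    n : ℕ

-- Arithmetic in ℚ and finite sums

fromℕ : ℕ → ℚ
fromℕ a = + a / 1

fromℕ≡mkℚ : ∀ a → fromℕ a ≡ mkℚ (+ a) 0 (Coprime.sym (1-coprimeTo a))
fromℕ≡mkℚ a = normalize-coprime (Coprime.sym (1-coprimeTo a))

fromℕ-+ : ∀ a b → fromℕ (a + b) ≡ fromℕ a ℚ.+ fromℕ b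
fromℕ-+ a b rewrite fromℕ≡mkℚ a | fromℕ≡mkℚ b =
  cong (_/ 1) (trans (ℤ.pos-+ a b) (sym (cong₂ _+ℤ_ (ℤ.*-identityʳ (+ a)) (ℤ.*-identityʳ (+ b)))))

fromℕ-* : ∀ a b → fromℕ (a ℕ.* b) ≡ fromℕ a * fromℕ b
fromℕ-* a b rewrite fromℕ≡mkℚ a | fromℕ≡mkℚ b = cong (_/ 1) (ℤ.pos-* a b)

fromℕ-inverse : ∀ a .{{_ : NonZero a}} → fromℕ a * (+ 1 / a) ≡ 1ℚ
fromℕ-inverse (suc a) rewrite fromℕ≡mkℚ (suc a) | normalize-coprime {1} {a} (1-coprimeTo (suc a)) =
  *-inverseʳ (mkℚ (+ suc a) 0 (Coprime.sym (1-coprimeTo (suc a))))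

x*[y*z]≡x*[u*y]*[v*z] : ∀ x y z u v → u * v ≡ 1ℚ → x * (y * z) ≡ x * (u * y) * (v * z)
x*[y*z]≡x*[u*y]*[v*z] x y z u v u*v≡1 = begin
  x * (y * z)                     ≡⟨ sym (*-identityʳ (x * (y * z))) ⟩
  x * (y * z) * 1ℚ                ≡⟨ cong (x * (y * z) *_) (sym u*v≡1) ⟩
  x * (y * z) * (u * v)           ≡⟨ *-assoc x (y * z) (u * v) ⟩
  x * ((y * z) * (u * v))         ≡⟨ cong (x *_) (*-interchange y z u v) ⟩
  x * ((y * u) * (z * v))         ≡⟨ cong (x *_) (cong₂ _*_ (*-comm y u) (*-comm z v)) ⟩
  x * ((u * y) * (v * z))         ≡⟨ sym (*-assoc x (u * y) (v * z)) ⟩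
  x * (u * y) * (v * z)           ∎
  where open ≡-Reasoning

nCk*[k!*[n∸k]!]≡n! : ∀ {n k} → k ≤ n → (n C k) ℕ.* (k ! ℕ.* (n ∸ k) !) ≡ n !
nCk*[k!*[n∸k]!]≡n! {n} {k} k≤n =
  trans (cong (ℕ._* (k ! ℕ.* (n ∸ k) !)) (nCk≡n!/k![n-k]! k≤n)) (m/n*n≡m (k![n∸k]!∣n! k≤n))
  where instance _ = k !* (n ∸ k) !≢0

m<o≤n⇒m+n∸o<n : ∀ {m n o} → m < o → o ≤ n → m + n ∸ o < n
m<o≤n⇒m+n∸o<n {m} {n} {o} m<o o≤n = begin-strict
  m + n ∸ o      ≡⟨ +-∸-assoc m o≤n ⟩
  m + (n ∸ o)    <⟨ +-monoˡ-< (n ∸ o) m<o ⟩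
  o + (n ∸ o)    ≡⟨ m+[n∸m]≡n o≤n ⟩
  n              ∎
  where open ≤-Reasoning

k>n⇒fromℕ[nCk]*x≡0 : ∀ {n k} x → k > n → fromℕ (n C k) * x ≡ 0ℚ
k>n⇒fromℕ[nCk]*x≡0 x k>n = trans (cong (λ a → fromℕ a * x) (k>n⇒nCk≡0 k>n)) (*-zeroˡ x)

∑< : ℕ → (ℕ → ℚ) → ℚ
∑< zero    f = 0ℚ
∑< (suc N) f = f 0 ℚ.+ ∑< N (f ∘ suc)

syntax ∑< N (λ i → e) = ∑[ i < N ] e

∑-cong : ∀ N {f g : ℕ → ℚ} → (∀ i → i < N → f i ≡ g i) → ∑< N f ≡ ∑< N g
∑-cong zero    f≡g = refl
∑-cong (suc N) f≡g = cong₂ ℚ._+_ (f≡g 0 (s≤s z≤n)) (∑-cong N (λ i i<N → f≡g (suc i) (s≤s i<N)))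

∑-zero : ∀ N {f : ℕ → ℚ} → (∀ i → i < N → f i ≡ 0ℚ) → ∑< N f ≡ 0ℚ
∑-zero zero    f≡0 = refl
∑-zero (suc N) f≡0 =
  trans (cong₂ ℚ._+_ (f≡0 0 (s≤s z≤n)) (∑-zero N (λ i i<N → f≡0 (suc i) (s≤s i<N)))) (+-identityʳ 0ℚ)

∑-truncate : ∀ K d {f : ℕ → ℚ} → (∀ i → K ≤ i → f i ≡ 0ℚ) → ∑< (K + d) f ≡ ∑< K f
∑-truncate zero    d f≡0 = ∑-zero d (λ i _ → f≡0 i z≤n)
∑-truncate (suc K) d {f} f≡0 = cong (f 0 ℚ.+_) (∑-truncate K d (λ i K≤i → f≡0 (suc i) (s≤s K≤i)))

∑-+ : ∀ N (f g : ℕ → ℚ) → ∑[ i < N ] (f i ℚ.+ g i) ≡ ∑< N f ℚ.+ ∑< N g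
∑-+ zero    f g = sym (+-identityʳ 0ℚ)
∑-+ (suc N) f g =
  trans (cong (f 0 ℚ.+ g 0 ℚ.+_) (∑-+ N (f ∘ suc) (g ∘ suc))) (+-interchange (f 0) (g 0) (∑< N (f ∘ suc)) (∑< N (g ∘ suc)))

*-distribˡ-∑ : ∀ N c (f : ℕ → ℚ) → c * ∑< N f ≡ ∑[ i < N ] (c * f i)
*-distribˡ-∑ zero    c f = *-zeroʳ c
*-distribˡ-∑ (suc N) c f = trans (*-distribˡ-+ c (f 0) (∑< N (f ∘ suc))) (cong (c * f 0 ℚ.+_) (*-distribˡ-∑ N c (f ∘ suc)))

if-T : ∀ {b} {x y : A} → T b → (if b then x else y) ≡ x
if-T {b = true} _ = refl

if-¬T : ∀ {b} {x y : A} → ¬ T b → (if b then x else y) ≡ y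
if-¬T {b = false} _  = refl
if-¬T {b = true}  ¬t = ⊥-elim (¬t tt)

-- Finite types with sizes in ℚ

_HasSize_ : Set → ℚ → Set
A HasSize q = Σ[ a ∈ ℕ ] (A ↔ Fin a) × fromℕ a ≡ q

↔-hasSize : A ↔ B → B HasSize q → A HasSize q
↔-hasSize A↔B (a , B↔a , a≡q) = a , ↔-trans A↔B B↔a , a≡q

⊎-hasSize : A HasSize p → B HasSize q → (A ⊎ B) HasSize (p ℚ.+ q)
⊎-hasSize (a , A↔a , refl) (b , B↔b , refl) = a + b , ↔-trans (A↔a ⊎-↔ B↔b) (↔-sym +↔⊎) , fromℕ-+ a b

empty-hasSize : ¬ A → A HasSize 0ℚ
empty-hasSize ¬A = 0 , mk↔ₛ′ (⊥-elim ∘ ¬A) (λ ()) (λ ()) (⊥-elim ∘ ¬A) , refl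

contractible-hasSize : (x : A) → (∀ y → x ≡ y) → A HasSize 1ℚ
contractible-hasSize x centre = 1 , ↔-trans (mk↔ₛ′ (λ _ → tt) (λ _ → x) (λ _ → refl) centre) (↔-sym 1↔⊤) , refl

T×-hasSize : ∀ b → (T b → A HasSize q) → (T b × A) HasSize (if b then q else 0ℚ)
T×-hasSize true  A-size = ↔-hasSize (mk↔ₛ′ proj₂ (tt ,_) (λ _ → refl) (λ _ → refl)) (A-size tt)
T×-hasSize false _      = empty-hasSize proj₁

-- Subsets of Fin n

-- Inclusion as a boolean: T (p ⊆ᵇ q) is proof-irrelevant, and sizes can branch on it.
_⊆ᵇ_ : Subset n → Subset n → Bool
[]            ⊆ᵇ []           = true
(outside ∷ B) ⊆ᵇ (_ ∷ S)      = B ⊆ᵇ S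
(inside ∷ B)  ⊆ᵇ (inside ∷ S)  = B ⊆ᵇ S
(inside ∷ B)  ⊆ᵇ (outside ∷ S) = false

Disjoint : Subset n → Subset n → Set
Disjoint p q = p ∩ q ≡ ⊥

Subset-≡-irrelevant : UIP (Subset n)
Subset-≡-irrelevant = Decidable⇒UIP.≡-irrelevant (≡-dec _≟ᵇ_)

p⊆ᵇp∪q : ∀ (p q : Subset n) → T (p ⊆ᵇ (p ∪ q))
p⊆ᵇp∪q []            []      = tt
p⊆ᵇp∪q (outside ∷ p) (_ ∷ q) = p⊆ᵇp∪q p q
p⊆ᵇp∪q (inside ∷ p)  (_ ∷ q) = p⊆ᵇp∪q p q

p∩q≡⊥⇒[p∪q]─p≡q : ∀ (p q : Subset n) → Disjoint p q → (p ∪ q) ─ p ≡ q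
p∩q≡⊥⇒[p∪q]─p≡q []            []            _  = refl
p∩q≡⊥⇒[p∪q]─p≡q (outside ∷ p) (x ∷ q)       pq = cong (x ∷_) (p∩q≡⊥⇒[p∪q]─p≡q p q (∷-injectiveʳ pq))
p∩q≡⊥⇒[p∪q]─p≡q (inside ∷ p)  (outside ∷ q) pq = cong (outside ∷_) (p∩q≡⊥⇒[p∪q]─p≡q p q (∷-injectiveʳ pq))
p∩q≡⊥⇒[p∪q]─p≡q (inside ∷ p)  (inside ∷ q)  pq with () ← ∷-injectiveˡ pq

p∩[q─p]≡⊥ : ∀ (p q : Subset n) → Disjoint p (q ─ p)
p∩[q─p]≡⊥ []            []      = refl
p∩[q─p]≡⊥ (outside ∷ p) (_ ∷ q) = cong (outside ∷_) (p∩[q─p]≡⊥ p q)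
p∩[q─p]≡⊥ (inside ∷ p)  (_ ∷ q) = cong (outside ∷_) (p∩[q─p]≡⊥ p q)

p⊆ᵇq⇒p∪[q─p]≡q : ∀ (p q : Subset n) → T (p ⊆ᵇ q) → p ∪ (q ─ p) ≡ q
p⊆ᵇq⇒p∪[q─p]≡q []            []           _   = refl
p⊆ᵇq⇒p∪[q─p]≡q (outside ∷ p) (x ∷ q)      p⊆q = cong (x ∷_) (p⊆ᵇq⇒p∪[q─p]≡q p q p⊆q)
p⊆ᵇq⇒p∪[q─p]≡q (inside ∷ p)  (inside ∷ q) p⊆q = cong (inside ∷_) (p⊆ᵇq⇒p∪[q─p]≡q p q p⊆q)

p⊆ᵇq⇒∣q─p∣+∣p∣≡∣q∣ : ∀ (p q : Subset n) → T (p ⊆ᵇ q) → ∣ q ─ p ∣ + ∣ p ∣ ≡ ∣ q ∣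
p⊆ᵇq⇒∣q─p∣+∣p∣≡∣q∣ []            []            _   = refl
p⊆ᵇq⇒∣q─p∣+∣p∣≡∣q∣ (outside ∷ p) (outside ∷ q) p⊆q = p⊆ᵇq⇒∣q─p∣+∣p∣≡∣q∣ p q p⊆q
p⊆ᵇq⇒∣q─p∣+∣p∣≡∣q∣ (outside ∷ p) (inside ∷ q)  p⊆q = cong suc (p⊆ᵇq⇒∣q─p∣+∣p∣≡∣q∣ p q p⊆q)
p⊆ᵇq⇒∣q─p∣+∣p∣≡∣q∣ (inside ∷ p)  (inside ∷ q)  p⊆q =
  trans (+-suc ∣ q ─ p ∣ ∣ p ∣) (cong suc (p⊆ᵇq⇒∣q─p∣+∣p∣≡∣q∣ p q p⊆q))

∣p∣≡0⇒p≡⊥ : ∀ (p : Subset n) → ∣ p ∣ ≡ 0 → p ≡ ⊥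
∣p∣≡0⇒p≡⊥ []            _      = refl
∣p∣≡0⇒p≡⊥ (outside ∷ p) ∣p∣≡0 = cong (outside ∷_) (∣p∣≡0⇒p≡⊥ p ∣p∣≡0)

p∪q≡⊥⇒p≡⊥×q≡⊥ : ∀ (p q : Subset n) → p ∪ q ≡ ⊥ → p ≡ ⊥ × q ≡ ⊥
p∪q≡⊥⇒p≡⊥×q≡⊥ []            []            _     = refl , refl
p∪q≡⊥⇒p≡⊥×q≡⊥ (outside ∷ p) (outside ∷ q) p∪q≡⊥ =
  let p≡⊥ , q≡⊥ = p∪q≡⊥⇒p≡⊥×q≡⊥ p q (∷-injectiveʳ p∪q≡⊥) in cong (outside ∷_) p≡⊥ , cong (outside ∷_) q≡⊥
p∪q≡⊥⇒p≡⊥×q≡⊥ (outside ∷ p) (inside ∷ q)  p∪q≡⊥ with () ← ∷-injectiveˡ p∪q≡⊥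
p∪q≡⊥⇒p≡⊥×q≡⊥ (inside ∷ p)  (_ ∷ q)       p∪q≡⊥ with () ← ∷-injectiveˡ p∪q≡⊥

Disjoint-⋃⁺ : ∀ (p : Subset n) {qs} → All (Disjoint p) qs → Disjoint p (⋃ qs)
Disjoint-⋃⁺ p []                         = ∩-zeroʳ p
Disjoint-⋃⁺ p {q ∷ qs} (p∩q≡⊥ ∷ p∩qs≡⊥) = begin
  p ∩ (q ∪ ⋃ qs)         ≡⟨ ∩-distribˡ-∪ p q (⋃ qs) ⟩
  (p ∩ q) ∪ (p ∩ ⋃ qs)   ≡⟨ cong₂ _∪_ p∩q≡⊥ (Disjoint-⋃⁺ p p∩qs≡⊥) ⟩
  ⊥ ∪ ⊥                  ≡⟨ ∪-identityˡ ⊥ ⟩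
  ⊥                      ∎
  where open ≡-Reasoning

Disjoint-⋃⁻ : ∀ (p : Subset n) qs → Disjoint p (⋃ qs) → All (Disjoint p) qs
Disjoint-⋃⁻ p []       _ = []
Disjoint-⋃⁻ p (q ∷ qs) p∩⋃≡⊥ =
  let p∩q≡⊥ , p∩qs≡⊥ = p∪q≡⊥⇒p≡⊥×q≡⊥ (p ∩ q) (p ∩ ⋃ qs) (trans (sym (∩-distribˡ-∪ p q (⋃ qs))) p∩⋃≡⊥)
  in p∩q≡⊥ ∷ Disjoint-⋃⁻ p qs p∩qs≡⊥

∑⊆ : ∀ n → (Subset n → ℚ) → ℚ
∑⊆ zero    f = f []
∑⊆ (suc n) f = ∑⊆ n (f ∘ (outside ∷_)) ℚ.+ ∑⊆ n (f ∘ (inside ∷_))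

∑⊆-zero : ∀ n → ∑⊆ n (λ _ → 0ℚ) ≡ 0ℚ
∑⊆-zero zero    = refl
∑⊆-zero (suc n) = trans (cong₂ ℚ._+_ (∑⊆-zero n) (∑⊆-zero n)) (+-identityʳ 0ℚ)

Σ-Subset-hasSize : ∀ n {P : Subset n → Set} {f : Subset n → ℚ} →
                   (∀ B → P B HasSize f B) → Σ (Subset n) P HasSize ∑⊆ n f
Σ-Subset-hasSize zero {P} sizes = ↔-hasSize Σ-Subset₀↔ (sizes [])
  where
  Σ-Subset₀↔ : Σ (Subset 0) P ↔ P []
  Σ-Subset₀↔ = mk↔ₛ′ (λ { ([] , x) → x }) ([] ,_) (λ _ → refl) (λ { ([] , _) → refl })
Σ-Subset-hasSize (suc n) {P} sizes =
  ↔-hasSize Σ-Subset-suc↔ (⊎-hasSize (Σ-Subset-hasSize n (sizes ∘ (outside ∷_)))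
                                     (Σ-Subset-hasSize n (sizes ∘ (inside ∷_))))
  where
  Σ-Subset-suc↔ : Σ (Subset (suc n)) P ↔ (Σ (Subset n) (P ∘ (outside ∷_)) ⊎ Σ (Subset n) (P ∘ (inside ∷_)))
  Σ-Subset-suc↔ = mk↔ₛ′
    (λ { (outside ∷ B , x) → inj₁ (B , x) ; (inside ∷ B , x) → inj₂ (B , x) })
    (λ { (inj₁ (B , x)) → outside ∷ B , x ; (inj₂ (B , x)) → inside ∷ B , x })
    (λ { (inj₁ _) → refl ; (inj₂ _) → refl })
    (λ { (outside ∷ _ , _) → refl ; (inside ∷ _ , _) → refl })

-- Any range N > n contains every size k ≤ ∣ S ∣.
binomial-∑⊆ : (S : Subset n) (g : ℕ → ℚ) (N : ℕ) → n < N →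
              ∑⊆ n (λ B → if B ⊆ᵇ S then g ∣ B ∣ else 0ℚ) ≡ ∑[ k < N ] (fromℕ (∣ S ∣ C k) * g k)
binomial-∑⊆ [] g (suc N) _ = sym (begin
  1ℚ * g 0 ℚ.+ ∑[ k < N ] (fromℕ (0 C suc k) * g (suc k))
    ≡⟨ cong₂ ℚ._+_ (*-identityˡ (g 0)) (∑-zero N (λ k _ → k>n⇒fromℕ[nCk]*x≡0 {0} {suc k} (g (suc k)) (s≤s z≤n))) ⟩
  g 0 ℚ.+ 0ℚ  ≡⟨ +-identityʳ (g 0) ⟩
  g 0       ∎)
  where open ≡-Reasoning
binomial-∑⊆ {suc n} (outside ∷ S) g N 1+n<N =
  trans (cong₂ ℚ._+_ (binomial-∑⊆ S g N (<⇒≤ 1+n<N)) (∑⊆-zero n)) (+-identityʳ (∑[ k < N ] (fromℕ (∣ S ∣ C k) * g k)))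
binomial-∑⊆ {suc n} (inside ∷ S) g (suc N) (s≤s n<N) = begin
  ∑⊆ n (λ B → if B ⊆ᵇ S then g ∣ B ∣ else 0ℚ) ℚ.+ ∑⊆ n (λ B → if B ⊆ᵇ S then g (suc ∣ B ∣) else 0ℚ)
    ≡⟨ cong₂ ℚ._+_ (binomial-∑⊆ S g (suc N) (m<n⇒m<1+n n<N)) (binomial-∑⊆ S (g ∘ suc) N n<N) ⟩
  (c 0 * g 0 ℚ.+ ∑[ k < N ] (c (suc k) * g (suc k))) ℚ.+ ∑[ k < N ] (c k * g (suc k))
    ≡⟨ +-assoc (c 0 * g 0) _ _ ⟩
  c 0 * g 0 ℚ.+ (∑[ k < N ] (c (suc k) * g (suc k)) ℚ.+ ∑[ k < N ] (c k * g (suc k)))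
    ≡⟨ cong (c 0 * g 0 ℚ.+_) (sym (∑-+ N (λ k → c (suc k) * g (suc k)) (λ k → c k * g (suc k)))) ⟩
  c 0 * g 0 ℚ.+ ∑[ k < N ] (c (suc k) * g (suc k) ℚ.+ c k * g (suc k))
    ≡⟨ cong (c 0 * g 0 ℚ.+_) (∑-cong N (λ k _ → pascal k)) ⟩
  c 0 * g 0 ℚ.+ ∑[ k < N ] (fromℕ (suc ∣ S ∣ C suc k) * g (suc k)) ∎
  where
  open ≡-Reasoning
  c : ℕ → ℚ
  c k = fromℕ (∣ S ∣ C k)
  pascal : ∀ k → c (suc k) * g (suc k) ℚ.+ c k * g (suc k) ≡ fromℕ (suc ∣ S ∣ C suc k) * g (suc k)
  pascal k = begin
    c (suc k) * g (suc k) ℚ.+ c k * g (suc k)   ≡⟨ sym (*-distribʳ-+ (g (suc k)) (c (suc k)) (c k)) ⟩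
    (c (suc k) ℚ.+ c k) * g (suc k)             ≡⟨ cong (_* g (suc k)) (sym (fromℕ-+ (∣ S ∣ C suc k) (∣ S ∣ C k))) ⟩
    fromℕ (∣ S ∣ C suc k + ∣ S ∣ C k) * g (suc k)
      ≡⟨ cong (λ a → fromℕ a * g (suc k)) (trans (+-comm (∣ S ∣ C suc k) (∣ S ∣ C k)) (nCk+nC[k+1]≡[n+1]C[k+1] ∣ S ∣ k)) ⟩
    fromℕ (suc ∣ S ∣ C suc k) * g (suc k)     ∎

-- r-Fibonacci numbers

invFactorial : ℕ → ℚ
invFactorial k = (+ 1 / suc k !) {{suc k !≢0}}

zipWith-fibHist : ∀ {r} (xs : Vec ℚ r) j (h : ℕ → ℚ) N → j ≤ N →
  foldr ℚ._+_ 0ℚ (zipWith _*_ (toList (tabulate {n = j} (h ∘ toℕ))) (fibHist r xs N))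
    ≡ ∑[ i < j ] (h i * rFib r xs (N ∸ suc i))
zipWith-fibHist     xs zero    h N       _         = refl
zipWith-fibHist {r} xs (suc j) h (suc N) (s≤s j≤N) =
  cong (h 0 * rFib r xs N ℚ.+_) (zipWith-fibHist xs j (h ∘ suc) N j≤N)

rFib-below : ∀ r' (xs : Vec ℚ (suc r')) {N} → N < r' → rFib (suc r') xs N ≡ 0ℚ
rFib-below r' xs N<r' = if-T (<⇒<ᵇ N<r')

rFib-initial : ∀ r' (xs : Vec ℚ (suc r')) → rFib (suc r') xs r' ≡ 1ℚ
rFib-initial r' xs = trans (if-¬T (<-irrefl refl ∘ <ᵇ⇒< r' r')) (if-T (≡⇒≡ᵇ r' r' refl))

rFib-recurrence : ∀ r' (h : ℕ → ℚ) {N} → r' < N → let xs = tabulate (h ∘ toℕ) in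
  rFib (suc r') xs N ≡ ∑[ i < suc r' ] (h i * rFib (suc r') xs (N ∸ suc i))
rFib-recurrence r' h {N} r'<N =
  trans (if-¬T (<⇒≱ r'<N ∘ <⇒≤ ∘ <ᵇ⇒< N r'))
        (trans (if-¬T (<⇒≢ r'<N ∘ sym ∘ ≡ᵇ⇒≡ N r'))
               (zipWith-fibHist (tabulate (h ∘ toℕ)) (suc r') h N r'<N))

-- Preference orderings

IsPrefOrderingOf : ℕ → Subset n → List (Subset n) → Set
IsPrefOrderingOf r S bs =
  All (λ b → 1 ≤ ∣ b ∣) bs × All (λ b → ∣ b ∣ ≤ r) bs × AllPairs Disjoint bs × ⋃ bs ≡ S

PrefOrderingOf : ℕ → Subset n → Set
PrefOrderingOf {n} r S = Σ (List (Subset n)) (IsPrefOrderingOf r S)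

IsPrefOrderingOf-irrelevant : ∀ r (S : Subset n) bs → Irrelevant (IsPrefOrderingOf r S bs)
IsPrefOrderingOf-irrelevant r S bs (ne , bd , dj , eq) (ne′ , bd′ , dj′ , eq′) =
  cong₂ _,_ (All.irrelevant ≤-irrelevant ne ne′)
    (cong₂ _,_ (All.irrelevant ≤-irrelevant bd bd′)
      (cong₂ _,_ (AllPairs.irrelevant Subset-≡-irrelevant dj dj′) (Subset-≡-irrelevant eq eq′)))

prefOrdering↔prefOrderingOf⊤ : ∀ {n r} → PrefOrdering n r ↔ PrefOrderingOf r ⊤
prefOrdering↔prefOrderingOf⊤ = mk↔ₛ′
  (λ { (prefOrdering bs ne bd dj cov) → bs , ne , bd , dj , cov })
  (λ { (bs , ne , bd , dj , cov) → prefOrdering bs ne bd dj cov })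
  (λ _ → refl) (λ _ → refl)

inBlockRange : ℕ → ℕ → Bool
inBlockRange r zero    = false
inBlockRange r (suc k) = k <ᵇ r

T-inBlockRange : ∀ r k → T (inBlockRange r k) ⇔ (1 ≤ k × k ≤ r)
T-inBlockRange r zero    = mk⇔ (λ ()) (λ { (() , _) })
T-inBlockRange r (suc k) = mk⇔ (λ k<r → s≤s z≤n , <ᵇ⇒< k r k<r) (<⇒<ᵇ ∘ proj₂)

prefOrderingOf-↔ : ∀ r (S : Subset n) →
  PrefOrderingOf r S ↔ (S ≡ ⊥ ⊎ Σ[ B ∈ Subset n ] T (B ⊆ᵇ S) × T (inBlockRange r ∣ B ∣) × PrefOrderingOf r (S ─ B))
prefOrderingOf-↔ {n} r S = mk↔ₛ′ uncons cons uncons∘cons cons∘uncons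
  where
  uncons : PrefOrderingOf r S → S ≡ ⊥ ⊎ Σ[ B ∈ Subset n ] T (B ⊆ᵇ S) × T (inBlockRange r ∣ B ∣) × PrefOrderingOf r (S ─ B)
  uncons ([] , _ , _ , _ , ⊥≡S) = inj₁ (sym ⊥≡S)
  uncons (B ∷ bs , ne ∷ nes , bd ∷ bds , dj ∷ djs , B∪⋃≡S) =
    inj₂ (B , B⊆S , Equivalence.from (T-inBlockRange r ∣ B ∣) (ne , bd) , bs , nes , bds , djs , ⋃≡S─B)
    where
    B⊆S : T (B ⊆ᵇ S)
    B⊆S = subst (λ X → T (B ⊆ᵇ X)) B∪⋃≡S (p⊆ᵇp∪q B (⋃ bs))
    ⋃≡S─B : ⋃ bs ≡ S ─ B
    ⋃≡S─B = trans (sym (p∩q≡⊥⇒[p∪q]─p≡q B (⋃ bs) (Disjoint-⋃⁺ B dj))) (cong (_─ B) B∪⋃≡S)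

  cons : S ≡ ⊥ ⊎ Σ[ B ∈ Subset n ] T (B ⊆ᵇ S) × T (inBlockRange r ∣ B ∣) × PrefOrderingOf r (S ─ B) → PrefOrderingOf r S
  cons (inj₁ S≡⊥) = [] , [] , [] , [] , sym S≡⊥
  cons (inj₂ (B , B⊆S , inRange , bs , nes , bds , djs , ⋃≡S─B)) =
    let ne , bd = Equivalence.to (T-inBlockRange r ∣ B ∣) inRange in
    B ∷ bs , ne ∷ nes , bd ∷ bds ,
    Disjoint-⋃⁻ B bs (subst (Disjoint B) (sym ⋃≡S─B) (p∩[q─p]≡⊥ B S)) ∷ djs ,
    trans (cong (B ∪_) ⋃≡S─B) (p⊆ᵇq⇒p∪[q─p]≡q B S B⊆S)

  uncons∘cons : ∀ x → uncons (cons x) ≡ x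
  uncons∘cons (inj₁ _) = cong inj₁ (Subset-≡-irrelevant _ _)
  uncons∘cons (inj₂ (B , _ , _ , bs , _)) =
    cong₂ (λ B⊆S rest → inj₂ (B , B⊆S , rest)) (T-irrelevant _ _)
      (cong₂ _,_ (T-irrelevant _ _) (cong (bs ,_) (IsPrefOrderingOf-irrelevant r (S ─ B) bs _ _)))

  cons∘uncons : ∀ o → cons (uncons o) ≡ o
  cons∘uncons ([] , _)                            = cong ([] ,_) (IsPrefOrderingOf-irrelevant r S [] _ _)
  cons∘uncons (B ∷ bs , _ ∷ _ , _ ∷ _ , _ ∷ _ , _) = cong (B ∷ bs ,_) (IsPrefOrderingOf-irrelevant r S (B ∷ bs) _ _)

δ₀ : ℕ → ℚ
δ₀ zero    = 1ℚ
δ₀ (suc _) = 0ℚ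

≡⊥-hasSize : ∀ (S : Subset n) m → ∣ S ∣ ≡ m → (S ≡ ⊥) HasSize δ₀ m
≡⊥-hasSize S     zero    ∣S∣≡0   = contractible-hasSize (∣p∣≡0⇒p≡⊥ S ∣S∣≡0) (Subset-≡-irrelevant _)
≡⊥-hasSize {n} S (suc _) ∣S∣≡1+m = empty-hasSize (λ S≡⊥ → 0≢1+n (trans (sym (∣⊥∣≡0 n)) (trans (cong ∣_∣ (sym S≡⊥)) ∣S∣≡1+m)))

-- Counting preference orderings with blocks of size at most suc r'

module _ (r' : ℕ) where

  private
    r : ℕ
    r = suc r'

    F : ℕ → ℚ
    F = rFib r (invFactorials r)

  prefCount : ℕ → ℚ
  prefCount m = fromℕ (m !) * F (m + r')

  tailCount : ℕ → ℕ → ℚ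
  tailCount m k = if inBlockRange r k then prefCount (m ∸ k) else 0ℚ

  tailCount-binomial : ∀ m i → i < r →
    fromℕ (suc m C suc i) * tailCount (suc m) (suc i) ≡ fromℕ (suc m !) * (invFactorial i * F (m + r' ∸ i))
  tailCount-binomial m i i<r = [ i≤m⇒lhs≡rhs , m<i⇒lhs≡rhs ]′ (≤-<-connex i m)
    where
    open ≡-Reasoning
    binom = suc m C suc i
    L = m ∸ i
    G = F (m + r' ∸ i)

    i≤m⇒lhs≡rhs : i ≤ m → fromℕ binom * tailCount (suc m) (suc i) ≡ fromℕ (suc m !) * (invFactorial i * G)
    i≤m⇒lhs≡rhs i≤m = begin
      fromℕ binom * tailCount (suc m) (suc i)
        ≡⟨ cong (fromℕ binom *_) (if-T (<⇒<ᵇ i<r)) ⟩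
      fromℕ binom * (fromℕ (L !) * F (L + r'))
        ≡⟨ cong (λ N → fromℕ binom * (fromℕ (L !) * F N)) (sym (+-∸-comm r' i≤m)) ⟩
      fromℕ binom * (fromℕ (L !) * G)
        ≡⟨ x*[y*z]≡x*[u*y]*[v*z] (fromℕ binom) (fromℕ (L !)) G (fromℕ (suc i !)) (invFactorial i)
                                 (fromℕ-inverse (suc i !) {{suc i !≢0}}) ⟩
      fromℕ binom * (fromℕ (suc i !) * fromℕ (L !)) * (invFactorial i * G)
        ≡⟨ cong (_* (invFactorial i * G)) (sym (trans (fromℕ-* binom (suc i ! ℕ.* L !))
                                                      (cong (fromℕ binom *_) (fromℕ-* (suc i !) (L !))))) ⟩
      fromℕ (binom ℕ.* (suc i ! ℕ.* L !)) * (invFactorial i * G)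
        ≡⟨ cong (λ a → fromℕ a * (invFactorial i * G)) (nCk*[k!*[n∸k]!]≡n! (s≤s i≤m)) ⟩
      fromℕ (suc m !) * (invFactorial i * G) ∎

    m<i⇒lhs≡rhs : m < i → fromℕ binom * tailCount (suc m) (suc i) ≡ fromℕ (suc m !) * (invFactorial i * G)
    m<i⇒lhs≡rhs m<i = begin
      fromℕ binom * tailCount (suc m) (suc i)
        ≡⟨ k>n⇒fromℕ[nCk]*x≡0 {suc m} {suc i} (tailCount (suc m) (suc i)) (s≤s m<i) ⟩
      0ℚ
        ≡⟨ sym (*-zeroʳ (fromℕ (suc m !))) ⟩
      fromℕ (suc m !) * 0ℚ
        ≡⟨ cong (fromℕ (suc m !) *_) (sym (*-zeroʳ (invFactorial i))) ⟩
      fromℕ (suc m !) * (invFactorial i * 0ℚ)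
        ≡⟨ cong (λ x → fromℕ (suc m !) * (invFactorial i * x))
                (sym (rFib-below r' (invFactorials r) (m<o≤n⇒m+n∸o<n m<i (s≤s⁻¹ i<r)))) ⟩
      fromℕ (suc m !) * (invFactorial i * G) ∎

  -- d only pads the range: the summands vanish for k > r.
  prefCount-recurrence : ∀ m d → δ₀ m ℚ.+ ∑[ k < suc (r + d) ] (fromℕ (m C k) * tailCount m k) ≡ prefCount m
  prefCount-recurrence zero d = begin
    1ℚ ℚ.+ (1ℚ * 0ℚ ℚ.+ ∑[ i < r + d ] (fromℕ (0 C suc i) * tailCount 0 (suc i)))
      ≡⟨ cong (1ℚ ℚ.+_) (cong₂ ℚ._+_ (*-zeroʳ 1ℚ) (∑-zero (r + d) (λ i _ → k>n⇒fromℕ[nCk]*x≡0 {0} {suc i} (tailCount 0 (suc i)) (s≤s z≤n)))) ⟩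
    1ℚ ℚ.+ (0ℚ ℚ.+ 0ℚ)
      ≡⟨⟩
    1ℚ
      ≡⟨ sym (trans (*-identityˡ (F r')) (rFib-initial r' (invFactorials r))) ⟩
    prefCount 0 ∎
    where open ≡-Reasoning
  prefCount-recurrence (suc m) d = begin
    0ℚ ℚ.+ (1ℚ * 0ℚ ℚ.+ ∑[ i < r + d ] term i)
      ≡⟨ +-identityˡ (1ℚ * 0ℚ ℚ.+ ∑[ i < r + d ] term i) ⟩
    1ℚ * 0ℚ ℚ.+ ∑[ i < r + d ] term i
      ≡⟨ cong (ℚ._+ ∑[ i < r + d ] term i) (*-zeroʳ 1ℚ) ⟩
    0ℚ ℚ.+ ∑[ i < r + d ] term i
      ≡⟨ +-identityˡ (∑[ i < r + d ] term i) ⟩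
    ∑[ i < r + d ] term i
      ≡⟨ ∑-truncate r d (λ i r≤i → term-vanishes i r≤i) ⟩
    ∑[ i < r ] term i
      ≡⟨ ∑-cong r (λ i i<r → tailCount-binomial m i i<r) ⟩
    ∑[ i < r ] (fromℕ (suc m !) * (invFactorial i * F (m + r' ∸ i)))
      ≡⟨ sym (*-distribˡ-∑ r (fromℕ (suc m !)) (λ i → invFactorial i * F (m + r' ∸ i))) ⟩
    fromℕ (suc m !) * ∑[ i < r ] (invFactorial i * F (m + r' ∸ i))
      ≡⟨ cong (fromℕ (suc m !) *_) (sym (rFib-recurrence r' invFactorial (s≤s (m≤n+m r' m)))) ⟩
    prefCount (suc m) ∎
    where
    open ≡-Reasoning
    term : ℕ → ℚ
    term i = fromℕ (suc m C suc i) * tailCount (suc m) (suc i)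
    term-vanishes : ∀ i → r ≤ i → term i ≡ 0ℚ
    term-vanishes i r≤i =
      trans (cong (fromℕ (suc m C suc i) *_) (if-¬T (λ i<r → <⇒≱ (<ᵇ⇒< i r i<r) r≤i))) (*-zeroʳ (fromℕ (suc m C suc i)))

  prefOrderingOf-hasSize : ∀ {n} fuel (S : Subset n) → ∣ S ∣ < fuel → PrefOrderingOf r S HasSize prefCount ∣ S ∣
  prefOrderingOf-hasSize {n} (suc fuel) S (s≤s ∣S∣≤fuel) =
    subst (PrefOrderingOf r S HasSize_) sizes-sum
      (↔-hasSize (prefOrderingOf-↔ r S) (⊎-hasSize (≡⊥-hasSize S m refl) (Σ-Subset-hasSize n firstBlock-hasSize)))
    where
    m = ∣ S ∣

    rest-hasSize : ∀ B → T (B ⊆ᵇ S) → T (inBlockRange r ∣ B ∣) → PrefOrderingOf r (S ─ B) HasSize prefCount (m ∸ ∣ B ∣)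
    rest-hasSize B B⊆S inRange = subst (λ k → PrefOrderingOf r (S ─ B) HasSize prefCount k) ∣S─B∣≡m∸∣B∣
      (prefOrderingOf-hasSize fuel (S ─ B) (<-≤-trans ∣S─B∣<m ∣S∣≤fuel))
      where
      ∣S─B∣+∣B∣≡m : ∣ S ─ B ∣ + ∣ B ∣ ≡ m
      ∣S─B∣+∣B∣≡m = p⊆ᵇq⇒∣q─p∣+∣p∣≡∣q∣ B S B⊆S
      ∣S─B∣<m : ∣ S ─ B ∣ < m
      ∣S─B∣<m = subst (∣ S ─ B ∣ <_) ∣S─B∣+∣B∣≡m (m<m+n ∣ S ─ B ∣ (proj₁ (Equivalence.to (T-inBlockRange r ∣ B ∣) inRange)))
      ∣S─B∣≡m∸∣B∣ : ∣ S ─ B ∣ ≡ m ∸ ∣ B ∣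
      ∣S─B∣≡m∸∣B∣ = trans (sym (m+n∸n≡m ∣ S ─ B ∣ ∣ B ∣)) (cong (_∸ ∣ B ∣) ∣S─B∣+∣B∣≡m)

    firstBlock-hasSize : ∀ B → (T (B ⊆ᵇ S) × T (inBlockRange r ∣ B ∣) × PrefOrderingOf r (S ─ B))
                               HasSize (if B ⊆ᵇ S then tailCount m ∣ B ∣ else 0ℚ)
    firstBlock-hasSize B =
      T×-hasSize (B ⊆ᵇ S) λ B⊆S → T×-hasSize (inBlockRange r ∣ B ∣) (rest-hasSize B B⊆S)

    sizes-sum : δ₀ m ℚ.+ ∑⊆ n (λ B → if B ⊆ᵇ S then tailCount m ∣ B ∣ else 0ℚ) ≡ prefCount m
    sizes-sum = trans (cong (δ₀ m ℚ.+_) (binomial-∑⊆ S (tailCount m) (suc (r + n)) (s≤s (m≤n+m n r))))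
                      (prefCount-recurrence m n)

-- The count is valid for n = 0 as well.
corollary4p8 : (r n : ℕ) → 1 ≤ r → 1 ≤ n →
    Σ ℕ (λ a → (PrefOrdering n r ↔ Fin a) ×
      (+ a / 1 ≡ (+ (n !) / 1) * rFib r (invFactorials r) (n + r ∸ 1)))
corollary4p8 zero     n () _
corollary4p8 (suc r') n _  _ =
  ↔-hasSize prefOrdering↔prefOrderingOf⊤
    (subst (λ N → PrefOrderingOf (suc r') (⊤ {n}) HasSize (fromℕ (n !) * rFib (suc r') (invFactorials (suc r')) N))
           (cong (_∸ 1) (sym (+-suc n r')))
           (subst (λ m → PrefOrderingOf (suc r') (⊤ {n}) HasSize prefCount r' m) (∣⊤∣≡n n)
                  (prefOrderingOf-hasSize r' (suc ∣ ⊤ {n} ∣) ⊤ ≤-refl)))
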